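{- For $|q|<1$, \[ \sum_{n\geq 0}(-1)^{n} q^{2n^2+n} \frac{(q;q^2)_{n+1}(-q^2;q^2)_{n}}{(q^2;q^2)_{2n+1}} = (q, -q^2;q^2)_\infty. \]
   Context: $q$-Pochhammer notation: $(a;q)_n=\prod_{j=0}^{n-1}(1-aq^j)$ for $n\ge1$, $(a;q)_0=1$, $(a;q)_\infty=\prod_{j\ge0}(1-aq^j)$, $(a,b;q)_\infty=(a;q)_\infty(b;q)_\infty$. -}

module Defs where

open import Data.Nat using (ℕ; zero; suc; _∸_) renaming (_+_ to _+ℕ_; _*_ to _*ℕ_; _≟_ to _≟ℕ_)
open import Data.Nat.DivMod using (_%_)
open import Data.Integer using (ℤ; +_; -_; _+_; _*_)
open import Relation.Nullary using (yes; no)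

-- Formal power series in q with integer coefficients: f N = coefficient of q^N.
PS : Set
PS = ℕ → ℤ

sumTo : ℕ → (ℕ → ℤ) → ℤ
sumTo zero    f = f 0
sumTo (suc n) f = sumTo n f + f (suc n)

_⊕_ : PS → PS → PS
(f ⊕ g) N = f N + g N

_⊛_ : PS → PS → PS
(f ⊛ g) N = sumTo N (λ i → f i * g (N ∸ i))

mono : ℤ → ℕ → PS
mono c k N with N ≟ℕ k
... | yes _ = c
... | no  _ = + 0

one : PS
one = mono (+ 1) 0

prodTo : ℕ → (ℕ → PS) → PS
prodTo zero    F = one
prodTo (suc n) F = prodTo n F ⊛ F n

-- (c q^k ; q^b)_n = Π_{j<n} (1 - c q^{k + b j})
poch : ℤ → ℕ → ℕ → ℕ → PS
poch c k b n = prodTo n (λ j → one ⊕ mono (- c) (k +ℕ b *ℕ j))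

-- 1/(1 - q^{suc m}) = Σ_{t≥0} q^{(suc m) t}
recipOneMinus : ℕ → PS
recipOneMinus m N with N % suc m
... | zero  = + 1
... | suc _ = + 0

-- 1/(q^{suc k} ; q^b)_n = Π_{j<n} 1/(1 - q^{suc k + b j})
invPoch : ℕ → ℕ → ℕ → PS
invPoch k b n = prodTo n (λ j → recipOneMinus (k +ℕ b *ℕ j))

-- (c q^{suc k} ; q^{suc b})_∞ : coefficient of q^N equals that of the
-- finite product with N+1 factors (the remaining factors are ≡ 1 mod q^{N+1}).
pochInf : ℤ → ℕ → ℕ → PS
pochInf c k b N = poch c (suc k) (suc b) (suc N) N

sign : ℕ → ℤ
sign zero    = + 1
sign (suc n) = - sign n

summand : ℕ → PS
summand n = mono (sign n) (2 *ℕ n *ℕ n +ℕ n)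
            ⊛ (poch (+ 1) 1 2 (suc n)
            ⊛ (poch (- (+ 1)) 2 2 n
            ⊛ invPoch 1 2 (suc (2 *ℕ n))))

-- Σ_{n≥0} summand n : summand n has order ≥ 2n^2+n ≥ n, so only n ≤ N
-- contribute to the coefficient of q^N.
lhs : PS
lhs N = sumTo N (λ n → summand n N)

rhs : PS
rhs = pochInf (+ 1) 0 1 ⊛ pochInf (- (+ 1)) 1 1

-- Write X_N = (-q;q²)_{N+1}. Its constant term is 1, so it suffices to show that both sides,
-- multiplied by X_N, are ≡ 1 modulo q^{N+1}.
--
-- Right side: (q;q²)(-q;q²) = (q²;q⁴), and the finite Euler identity
-- (q²;q⁴)_M (-q²;q²)_{2M} = (q^{4M+4};q⁴)_M ≡ 1 modulo q^M.
--
-- Left side: (q;q²)_{n+1} (-q;q²)_{n+1} (-q²;q²)_n (q²;q²)_n = (q²;q²)_{2n+1}, so the n-th summand times X_N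
-- is (-1)^n q^{2n²+n} (-q^{2n+3};q²)_{N-n} / (q²;q²)_n. Modulo q^{N+1} the factor 1/(q²;q²)_n may be replaced
-- by the Gaussian binomial [N, n]_{q²}, and the resulting terminating sum
--   Σ_{n ≤ N} (-1)^n q^{2n²+an} [N, n]_{q²} (-q^{a+2n+2};q²)_{N-n} = 1
-- holds for every a, by induction on N through the q-Pascal recurrence.

module Submission where

open import Defs
open import Data.Nat using (ℕ)
open import Relation.Binary.PropositionalEquality using (_≡_)

open import Data.Nat using (zero; suc; _∸_; _≤_; _<_; z≤n; s≤s)
  renaming (_+_ to _+ℕ_; _*_ to _*ℕ_)
import Data.Nat.Properties as ℕ
open import Data.Nat.DivMod using (m≤n⇒[n∸m]%m≡n%m; m<n⇒m%n≡m)
open import Data.Integer using (ℤ; +_; -_; _+_; _*_)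
import Data.Integer.Properties as ℤ
open import Data.Sum using (_⊎_; inj₁; inj₂)
open import Data.Empty using (⊥-elim)
open import Function using (_∘_)
open import Relation.Nullary using (¬_; yes; no)
open import Relation.Binary.PropositionalEquality using (refl; sym; trans; cong; cong₂; subst; subst₂; module ≡-Reasoning)
open import Relation.Binary.Bundles using (Setoid)
open import Relation.Binary.Structures using (IsEquivalence)
open import Algebra.Bundles using (CommutativeSemiring; AbelianGroup)
open import Algebra.Structures.Biased using (IsCommutativeMonoidˡ; isCommutativeSemiringʳ)
import Relation.Binary.Reasoning.Setoid
open import Data.Nat.Tactic.RingSolver using (solve-∀)
open import Algebra.Properties.CommutativeSemigroup ℤ.+-commutativeSemigroup using (interchange)
open import Algebra.Properties.Group (AbelianGroup.group ℤ.+-0-abelianGroup) using (∙-cancelˡ)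

sumTo-cong : ∀ n {f g : ℕ → ℤ} → (∀ i → i ≤ n → f i ≡ g i) → sumTo n f ≡ sumTo n g
sumTo-cong zero    f≡g = f≡g 0 z≤n
sumTo-cong (suc n) f≡g = cong₂ _+_ (sumTo-cong n λ i i≤n → f≡g i (ℕ.m≤n⇒m≤1+n i≤n)) (f≡g (suc n) ℕ.≤-refl)

sumTo-zero : ∀ n {f : ℕ → ℤ} → (∀ i → i ≤ n → f i ≡ + 0) → sumTo n f ≡ + 0
sumTo-zero zero    f≡0 = f≡0 0 z≤n
sumTo-zero (suc n) f≡0 = cong₂ _+_ (sumTo-zero n λ i i≤n → f≡0 i (ℕ.m≤n⇒m≤1+n i≤n)) (f≡0 (suc n) ℕ.≤-refl)

sumTo-+ : ∀ n (f g : ℕ → ℤ) → sumTo n (λ i → f i + g i) ≡ sumTo n f + sumTo n g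
sumTo-+ zero    f g = refl
sumTo-+ (suc n) f g = trans (cong (_+ (f (suc n) + g (suc n))) (sumTo-+ n f g))
                            (interchange (sumTo n f) (sumTo n g) (f (suc n)) (g (suc n)))

sumTo-*ˡ : ∀ n c (f : ℕ → ℤ) → c * sumTo n f ≡ sumTo n (λ i → c * f i)
sumTo-*ˡ zero    c f = refl
sumTo-*ˡ (suc n) c f = trans (ℤ.*-distribˡ-+ c (sumTo n f) (f (suc n))) (cong (_+ c * f (suc n)) (sumTo-*ˡ n c f))

sumTo-*ʳ : ∀ n c (f : ℕ → ℤ) → sumTo n f * c ≡ sumTo n (λ i → f i * c)
sumTo-*ʳ n c f = trans (ℤ.*-comm (sumTo n f) c) (trans (sumTo-*ˡ n c f) (sumTo-cong n λ i _ → ℤ.*-comm c (f i)))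

sumTo-suc : ∀ n (f : ℕ → ℤ) → sumTo (suc n) f ≡ f 0 + sumTo n (f ∘ suc)
sumTo-suc zero    f = refl
sumTo-suc (suc n) f = trans (cong (_+ f (suc (suc n))) (sumTo-suc n f)) (ℤ.+-assoc (f 0) _ _)

sumTo-reverse : ∀ n (f : ℕ → ℤ) → sumTo n f ≡ sumTo n (λ i → f (n ∸ i))
sumTo-reverse zero    f = refl
sumTo-reverse (suc n) f = begin
  sumTo n f + f (suc n)                     ≡⟨ ℤ.+-comm (sumTo n f) _ ⟩
  f (suc n) + sumTo n f                     ≡⟨ cong (_+_ (f (suc n))) (sumTo-reverse n f) ⟩
  f (suc n) + sumTo n (λ i → f (n ∸ i))     ≡⟨ sumTo-suc n (λ i → f (suc n ∸ i)) ⟨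
  sumTo (suc n) (λ i → f (suc n ∸ i))       ∎
  where open ≡-Reasoning

sumTo-swap : ∀ n m (F : ℕ → ℕ → ℤ) → sumTo n (λ i → sumTo m (F i)) ≡ sumTo m (λ j → sumTo n (λ i → F i j))
sumTo-swap zero    m F = refl
sumTo-swap (suc n) m F = trans (cong (_+ sumTo m (F (suc n))) (sumTo-swap n m F))
                               (sym (sumTo-+ m (λ j → sumTo n (λ i → F i j)) (F (suc n))))

sumTo-triangle : ∀ N (F : ℕ → ℕ → ℤ) →
  sumTo N (λ k → sumTo k (λ i → F i (k ∸ i))) ≡ sumTo N (λ i → sumTo (N ∸ i) (F i))
sumTo-triangle zero    F = refl
sumTo-triangle (suc N) F = begin
  sumTo N (λ k → sumTo k (λ i → F i (k ∸ i))) + (sumTo N (λ i → F i (suc N ∸ i)) + F (suc N) (N ∸ N))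
    ≡⟨ cong₂ (λ s t → s + (sumTo N (λ i → F i (suc N ∸ i)) + F (suc N) t)) (sumTo-triangle N F) (ℕ.n∸n≡0 N) ⟩
  sumTo N (λ i → sumTo (N ∸ i) (F i)) + (sumTo N (λ i → F i (suc N ∸ i)) + F (suc N) 0)
    ≡⟨ ℤ.+-assoc (sumTo N (λ i → sumTo (N ∸ i) (F i))) _ _ ⟨
  (sumTo N (λ i → sumTo (N ∸ i) (F i)) + sumTo N (λ i → F i (suc N ∸ i))) + F (suc N) 0
    ≡⟨ cong (_+ F (suc N) 0) (sumTo-+ N _ _) ⟨
  sumTo N (λ i → sumTo (N ∸ i) (F i) + F i (suc N ∸ i)) + F (suc N) 0
    ≡⟨ cong₂ _+_ (sumTo-cong N extendRow) (cong (λ m → sumTo m (F (suc N))) (sym (ℕ.n∸n≡0 N))) ⟩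
  sumTo N (λ i → sumTo (suc N ∸ i) (F i)) + sumTo (N ∸ N) (F (suc N))
    ∎
  where
  open ≡-Reasoning
  extendRow : ∀ i → i ≤ N → sumTo (N ∸ i) (F i) + F i (suc N ∸ i) ≡ sumTo (suc N ∸ i) (F i)
  extendRow i i≤N rewrite ℕ.+-∸-assoc 1 i≤N = refl

sumTo-extend : ∀ {i} N (f : ℕ → ℤ) → i ≤ N → (∀ n → i < n → n ≤ N → f n ≡ + 0) → sumTo i f ≡ sumTo N f
sumTo-extend zero    f z≤n _   = refl
sumTo-extend (suc N) f i≤1+N f≡0 with ℕ.m≤n⇒m<n∨m≡n i≤1+N
... | inj₂ refl          = refl
... | inj₁ (s≤s i≤N) =
  trans (sumTo-extend N f i≤N λ n i<n n≤N → f≡0 n i<n (ℕ.m≤n⇒m≤1+n n≤N))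
        (sym (trans (cong (_+_ (sumTo N f)) (f≡0 (suc N) (s≤s i≤N) ℕ.≤-refl)) (ℤ.+-identityʳ (sumTo N f))))

infix 4 _≈_
record _≈_ (f g : PS) : Set where
  constructor coeffwise
  field coeff : ∀ N → f N ≡ g N
open _≈_

≈-refl : ∀ {f} → f ≈ f
≈-refl = coeffwise λ _ → refl

≈-sym : ∀ {f g} → f ≈ g → g ≈ f
≈-sym f≈g = coeffwise λ N → sym (coeff f≈g N)

≈-trans : ∀ {f g h} → f ≈ g → g ≈ h → f ≈ h
≈-trans f≈g g≈h = coeffwise λ N → trans (coeff f≈g N) (coeff g≈h N)

≈-isEquivalence : IsEquivalence _≈_
≈-isEquivalence = record { refl = ≈-refl ; sym = ≈-sym ; trans = ≈-trans }

zeroPS : PS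
zeroPS _ = + 0

mono-≡ : ∀ c k → mono c k k ≡ c
mono-≡ c k with k ℕ.≟ k
... | yes _   = refl
... | no k≢k = ⊥-elim (k≢k refl)

mono-≢ : ∀ c k N → ¬ N ≡ k → mono c k N ≡ + 0
mono-≢ c k N N≢k with N ℕ.≟ k
... | yes N≡k = ⊥-elim (N≢k N≡k)
... | no _    = refl

sumTo-mono-< : ∀ N c k (g : ℕ → ℤ) → N < k → sumTo N (λ i → mono c k i * g i) ≡ + 0
sumTo-mono-< N c k g N<k = sumTo-zero N λ i i≤N →
  trans (cong (_* g i) (mono-≢ c k i λ { refl → ℕ.<-irrefl refl (ℕ.≤-<-trans i≤N N<k) })) (ℤ.*-zeroˡ (g i))

sumTo-mono-≤ : ∀ N c k (g : ℕ → ℤ) → k ≤ N → sumTo N (λ i → mono c k i * g i) ≡ c * g k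
sumTo-mono-≤ zero    c zero g z≤n = cong (_* g 0) (mono-≡ c 0)
sumTo-mono-≤ (suc N) c k g k≤1+N with ℕ.m≤n⇒m<n∨m≡n k≤1+N
... | inj₁ (s≤s k≤N) =
  trans (cong₂ _+_ (sumTo-mono-≤ N c k g k≤N)
                   (trans (cong (_* g (suc N)) (mono-≢ c k (suc N) λ { refl → ℕ.<-irrefl refl (s≤s k≤N) })) (ℤ.*-zeroˡ (g (suc N)))))
        (ℤ.+-identityʳ (c * g k))
... | inj₂ refl =
  trans (cong₂ _+_ (sumTo-mono-< N c (suc N) g ℕ.≤-refl) (cong (_* g (suc N)) (mono-≡ c (suc N))))
        (ℤ.+-identityˡ (c * g (suc N)))

mono-⊛-coeff : ∀ c k f {N} → k ≤ N → (mono c k ⊛ f) N ≡ c * f (N ∸ k)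
mono-⊛-coeff c k f {N} = sumTo-mono-≤ N c k (λ i → f (N ∸ i))

mono-⊛-coeff-< : ∀ c k f {N} → N < k → (mono c k ⊛ f) N ≡ + 0
mono-⊛-coeff-< c k f {N} = sumTo-mono-< N c k (λ i → f (N ∸ i))

⊕-cong : ∀ {f f′ g g′} → f ≈ f′ → g ≈ g′ → f ⊕ g ≈ f′ ⊕ g′
⊕-cong f≈f′ g≈g′ = coeffwise λ N → cong₂ _+_ (coeff f≈f′ N) (coeff g≈g′ N)

⊛-cong : ∀ {f f′ g g′} → f ≈ f′ → g ≈ g′ → f ⊛ g ≈ f′ ⊛ g′
⊛-cong f≈f′ g≈g′ = coeffwise λ N → sumTo-cong N λ i _ → cong₂ _*_ (coeff f≈f′ i) (coeff g≈g′ (N ∸ i))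

⊛-comm : ∀ f g → f ⊛ g ≈ g ⊛ f
⊛-comm f g = coeffwise λ N → trans (sumTo-reverse N _) (sumTo-cong N λ i i≤N →
  trans (cong (λ j → f (N ∸ i) * g j) (ℕ.m∸[m∸n]≡n i≤N)) (ℤ.*-comm (f (N ∸ i)) (g i)))

⊛-assoc : ∀ f g h → (f ⊛ g) ⊛ h ≈ f ⊛ (g ⊛ h)
⊛-assoc f g h = coeffwise λ N → begin
  sumTo N (λ k → sumTo k (λ i → f i * g (k ∸ i)) * h (N ∸ k))
    ≡⟨ sumTo-cong N (λ k _ → sumTo-*ʳ k (h (N ∸ k)) _) ⟩
  sumTo N (λ k → sumTo k (λ i → f i * g (k ∸ i) * h (N ∸ k)))
    ≡⟨ sumTo-cong N (λ k _ → sumTo-cong k λ i i≤k → cong (λ m → f i * g (k ∸ i) * h m) (split N i≤k)) ⟩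
  sumTo N (λ k → sumTo k (λ i → f i * g (k ∸ i) * h (N ∸ i ∸ (k ∸ i))))
    ≡⟨ sumTo-triangle N (λ i j → f i * g j * h (N ∸ i ∸ j)) ⟩
  sumTo N (λ i → sumTo (N ∸ i) (λ j → f i * g j * h (N ∸ i ∸ j)))
    ≡⟨ sumTo-cong N (λ i _ → trans (sumTo-cong (N ∸ i) λ j _ → ℤ.*-assoc (f i) (g j) _)
                                    (sym (sumTo-*ˡ (N ∸ i) (f i) _))) ⟩
  sumTo N (λ i → f i * sumTo (N ∸ i) (λ j → g j * h (N ∸ i ∸ j)))
    ∎
  where
  open ≡-Reasoning
  split : ∀ N {i k} → i ≤ k → N ∸ k ≡ N ∸ i ∸ (k ∸ i)
  split N {i} {k} i≤k = trans (cong (N ∸_) (sym (ℕ.m+[n∸m]≡n i≤k))) (sym (ℕ.∸-+-assoc N i (k ∸ i)))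

⊛-distribˡ : ∀ f g h → f ⊛ (g ⊕ h) ≈ (f ⊛ g) ⊕ (f ⊛ h)
⊛-distribˡ f g h = coeffwise λ N →
  trans (sumTo-cong N λ i _ → ℤ.*-distribˡ-+ (f i) (g (N ∸ i)) (h (N ∸ i))) (sumTo-+ N _ _)

⊛-zeroʳ : ∀ f → f ⊛ zeroPS ≈ zeroPS
⊛-zeroʳ f = coeffwise λ N → sumTo-zero N λ i _ → ℤ.*-zeroʳ (f i)

⊛-identityˡ : ∀ f → one ⊛ f ≈ f
⊛-identityˡ f = coeffwise λ N → trans (mono-⊛-coeff (+ 1) 0 f z≤n) (ℤ.*-identityˡ (f N))

PS-commutativeSemiring : CommutativeSemiring _ _
PS-commutativeSemiring = record
  { Carrier = PS ; _≈_ = _≈_ ; _+_ = _⊕_ ; _*_ = _⊛_ ; 0# = zeroPS ; 1# = one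
  ; isCommutativeSemiring = isCommutativeSemiringʳ record
    { +-isCommutativeMonoid = IsCommutativeMonoidˡ.isCommutativeMonoid record
      { isSemigroup = record
        { isMagma = record { isEquivalence = ≈-isEquivalence ; ∙-cong = ⊕-cong }
        ; assoc = λ f g h → coeffwise λ N → ℤ.+-assoc (f N) (g N) (h N) }
      ; identityˡ = λ f → coeffwise λ N → ℤ.+-identityˡ (f N)
      ; comm = λ f g → coeffwise λ N → ℤ.+-comm (f N) (g N) }
    ; *-isCommutativeMonoid = IsCommutativeMonoidˡ.isCommutativeMonoid record
      { isSemigroup = record
        { isMagma = record { isEquivalence = ≈-isEquivalence ; ∙-cong = ⊛-cong }
        ; assoc = ⊛-assoc }
      ; identityˡ = ⊛-identityˡ
      ; comm = ⊛-comm }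
    ; distribˡ = ⊛-distribˡ
    ; zeroʳ = ⊛-zeroʳ } }

open CommutativeSemiring PS-commutativeSemiring
  using (setoid) renaming (*-identityʳ to ⊛-identityʳ; zeroˡ to ⊛-zeroˡ; +-identityˡ to ⊕-identityˡ; +-identityʳ to ⊕-identityʳ)

open import Algebra.Solver.Ring.NaturalCoefficients.Default PS-commutativeSemiring using (solve; _:=_; _:+_; _:*_; con)
module ≈-Reasoning = Relation.Binary.Reasoning.Setoid setoid


-- The fixed factor h is explicit: unification cannot recover it from the coefficients of a product.
⊛-congˡ : ∀ h {f g} → f ≈ g → h ⊛ f ≈ h ⊛ g
⊛-congˡ h f≈g = ⊛-cong (≈-refl {h}) f≈g

⊛-congʳ : ∀ h {f g} → f ≈ g → f ⊛ h ≈ g ⊛ h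
⊛-congʳ h f≈g = ⊛-cong f≈g (≈-refl {h})

⊕-congˡ : ∀ h {f g} → f ≈ g → h ⊕ f ≈ h ⊕ g
⊕-congˡ h f≈g = ⊕-cong (≈-refl {h}) f≈g

⊕-congʳ : ∀ h {f g} → f ≈ g → f ⊕ h ≈ g ⊕ h
⊕-congʳ h f≈g = ⊕-cong f≈g (≈-refl {h})

≡⇒≈ : ∀ {f g} → f ≡ g → f ≈ g
≡⇒≈ refl = ≈-refl

mono-⊛-mono : ∀ a b k l → mono a k ⊛ mono b l ≈ mono (a * b) (k +ℕ l)
mono-⊛-mono a b k l = coeffwise coeffAt
  where
  coeffAt : ∀ N → (mono a k ⊛ mono b l) N ≡ mono (a * b) (k +ℕ l) N
  coeffAt N with k ℕ.≤? N
  ... | no k≰N = trans (mono-⊛-coeff-< a k (mono b l) (ℕ.≰⇒> k≰N))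
                       (sym (mono-≢ (a * b) (k +ℕ l) N λ { refl → k≰N (ℕ.m≤m+n k l) }))
  ... | yes k≤N with N ℕ.≟ k +ℕ l
  ...   | yes refl = trans (mono-⊛-coeff a k (mono b l) k≤N)
                           (trans (cong (λ m → a * mono b l m) (ℕ.m+n∸m≡n k l)) (cong (a *_) (mono-≡ b l)))
  ...   | no N≢k+l = trans (mono-⊛-coeff a k (mono b l) k≤N)
                           (trans (cong (a *_) (mono-≢ b l (N ∸ k) λ N∸k≡l →
                                    N≢k+l (trans (sym (ℕ.m+[n∸m]≡n k≤N)) (cong (k +ℕ_) N∸k≡l))))
                                  (ℤ.*-zeroʳ a))

mono-⊕-neg : ∀ c k → mono c k ⊕ mono (- c) k ≈ zeroPS
mono-⊕-neg c k = coeffwise coeffAt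
  where
  coeffAt : ∀ N → mono c k N + mono (- c) k N ≡ + 0
  coeffAt N with N ℕ.≟ k
  ... | yes _ = ℤ.+-inverseʳ c
  ... | no _  = refl

factor : ℤ → ℕ → PS
factor c e = one ⊕ mono (- c) e

factor-⊛-conjugate : ∀ e → factor (+ 1) e ⊛ factor (- (+ 1)) e ≈ factor (+ 1) (e +ℕ e)
factor-⊛-conjugate e = begin
  (one ⊕ u) ⊛ (one ⊕ v)
    ≈⟨ solve 2 (λ u v → (con 1 :+ u) :* (con 1 :+ v) := (con 1 :+ (u :+ v)) :+ u :* v) ≈-refl u v ⟩
  (one ⊕ (u ⊕ v)) ⊕ (u ⊛ v)
    ≈⟨ ⊕-cong (⊕-congˡ one (mono-⊕-neg (- (+ 1)) e)) (mono-⊛-mono (- (+ 1)) (+ 1) e e) ⟩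
  (one ⊕ zeroPS) ⊕ mono (- (+ 1)) (e +ℕ e)
    ≈⟨ ⊕-congʳ (mono (- (+ 1)) (e +ℕ e)) (⊕-identityʳ one) ⟩
  factor (+ 1) (e +ℕ e)
    ∎
  where
  open ≈-Reasoning
  u = mono (- (+ 1)) e
  v = mono (+ 1) e

prodTo-cong : ∀ n {F G : ℕ → PS} → (∀ j → j < n → F j ≈ G j) → prodTo n F ≈ prodTo n G
prodTo-cong zero    F≈G = ≈-refl
prodTo-cong (suc n) F≈G = ⊛-cong (prodTo-cong n λ j j<n → F≈G j (ℕ.m<n⇒m<1+n j<n)) (F≈G n ℕ.≤-refl)

prodTo-⊛ : ∀ n (F G : ℕ → PS) → prodTo n (λ j → F j ⊛ G j) ≈ prodTo n F ⊛ prodTo n G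
prodTo-⊛ zero    F G = ≈-sym (⊛-identityˡ one)
prodTo-⊛ (suc n) F G = begin
  prodTo n (λ j → F j ⊛ G j) ⊛ (F n ⊛ G n)         ≈⟨ ⊛-congʳ (F n ⊛ G n) (prodTo-⊛ n F G) ⟩
  (prodTo n F ⊛ prodTo n G) ⊛ (F n ⊛ G n)          ≈⟨ solve 4 (λ a b c d → (a :* b) :* (c :* d) := (a :* c) :* (b :* d)) ≈-refl
                                                                (prodTo n F) (prodTo n G) (F n) (G n) ⟩
  (prodTo n F ⊛ F n) ⊛ (prodTo n G ⊛ G n)          ∎
  where open ≈-Reasoning

prodTo-one : ∀ n → prodTo n (λ _ → one) ≈ one
prodTo-one zero    = ≈-refl
prodTo-one (suc n) = ≈-trans (⊛-identityʳ _) (prodTo-one n)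

prodTo-+ : ∀ m n (F : ℕ → PS) → prodTo (m +ℕ n) F ≈ prodTo m F ⊛ prodTo n (λ j → F (m +ℕ j))
prodTo-+ m zero    F = ≈-trans (≡⇒≈ (cong (λ l → prodTo l F) (ℕ.+-identityʳ m))) (≈-sym (⊛-identityʳ _))
prodTo-+ m (suc n) F = begin
  prodTo (m +ℕ suc n) F                                          ≈⟨ ≡⇒≈ (cong (λ l → prodTo l F) (ℕ.+-suc m n)) ⟩
  prodTo (m +ℕ n) F ⊛ F (m +ℕ n)                                  ≈⟨ ⊛-congʳ (F (m +ℕ n)) (prodTo-+ m n F) ⟩
  (prodTo m F ⊛ prodTo n (λ j → F (m +ℕ j))) ⊛ F (m +ℕ n)
    ≈⟨ ⊛-assoc (prodTo m F) (prodTo n (λ j → F (m +ℕ j))) (F (m +ℕ n)) ⟩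
  prodTo m F ⊛ prodTo (suc n) (λ j → F (m +ℕ j))                  ∎
  where open ≈-Reasoning

poch-+ : ∀ c k b m n → poch c k b (m +ℕ n) ≈ poch c k b m ⊛ poch c (k +ℕ b *ℕ m) b n
poch-+ c k b m n = ≈-trans (prodTo-+ m n _) (⊛-congˡ (poch c k b m) (prodTo-cong n λ j _ → ≡⇒≈ (cong (factor c) (exponent j))))
  where
  exponent : ∀ j → k +ℕ b *ℕ (m +ℕ j) ≡ k +ℕ b *ℕ m +ℕ b *ℕ j
  exponent j = trans (cong (k +ℕ_) (ℕ.*-distribˡ-+ b m j)) (sym (ℕ.+-assoc k (b *ℕ m) (b *ℕ j)))

poch-suc : ∀ c k b n → poch c k b (suc n) ≈ factor c k ⊛ poch c (k +ℕ b) b n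
poch-suc c k b n = ≈-trans (poch-+ c k b 1 n)
  (⊛-cong (≈-trans (⊛-identityˡ _) (≡⇒≈ (cong (factor c) (exponent₀ k b))))
          (≡⇒≈ (cong (λ e → poch c e b n) (exponent₁ k b))))
  where
  exponent₀ : ∀ k b → k +ℕ b *ℕ 0 ≡ k
  exponent₀ = solve-∀
  exponent₁ : ∀ k b → k +ℕ b *ℕ 1 ≡ k +ℕ b
  exponent₁ = solve-∀

poch-conjugate : ∀ k b n → poch (+ 1) k b n ⊛ poch (- (+ 1)) k b n ≈ poch (+ 1) (k +ℕ k) (b +ℕ b) n
poch-conjugate k b n = ≈-trans (≈-sym (prodTo-⊛ n _ _)) (prodTo-cong n λ j _ →
  ≈-trans (factor-⊛-conjugate (k +ℕ b *ℕ j)) (≡⇒≈ (cong (factor (+ 1)) (exponent k b j))))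
  where
  exponent : ∀ k b j → k +ℕ b *ℕ j +ℕ (k +ℕ b *ℕ j) ≡ k +ℕ k +ℕ (b +ℕ b) *ℕ j
  exponent = solve-∀

poch-odd-split : ∀ c k b n → poch c k b (suc (n +ℕ n)) ≈ poch c k (b +ℕ b) (suc n) ⊛ poch c (k +ℕ b) (b +ℕ b) n
poch-odd-split c k b zero    = ≈-sym (≈-trans (⊛-identityʳ _)
  (≡⇒≈ (cong (λ e → one ⊛ factor c (k +ℕ e)) (trans (ℕ.*-zeroʳ (b +ℕ b)) (sym (ℕ.*-zeroʳ b))))))
poch-odd-split c k b (suc n) = begin
  poch c k b (suc (suc n +ℕ suc n))
    ≈⟨ ≡⇒≈ (cong (λ m → poch c k b (suc (suc m))) (ℕ.+-suc n n)) ⟩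
  (poch c k b (suc (n +ℕ n)) ⊛ x) ⊛ y
    ≈⟨ ⊛-congʳ y (⊛-congʳ x (poch-odd-split c k b n)) ⟩
  ((A ⊛ B) ⊛ x) ⊛ y
    ≈⟨ solve 4 (λ A B x y → ((A :* B) :* x) :* y := (A :* y) :* (B :* x)) ≈-refl A B x y ⟩
  (A ⊛ y) ⊛ (B ⊛ x)
    ≈⟨ ⊛-cong (⊛-congˡ A (≡⇒≈ (cong (factor c) (exponentʸ k b n))))
              (⊛-congˡ B (≡⇒≈ (cong (factor c) (exponentˣ k b n)))) ⟩
  poch c k (b +ℕ b) (suc (suc n)) ⊛ poch c (k +ℕ b) (b +ℕ b) (suc n)
    ∎
  where
  open ≈-Reasoning
  A = poch c k (b +ℕ b) (suc n)
  B = poch c (k +ℕ b) (b +ℕ b) n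
  x = factor c (k +ℕ b *ℕ suc (n +ℕ n))
  y = factor c (k +ℕ b *ℕ suc (suc (n +ℕ n)))
  exponentʸ : ∀ k b n → k +ℕ b *ℕ suc (suc (n +ℕ n)) ≡ k +ℕ (b +ℕ b) *ℕ suc n
  exponentʸ = solve-∀
  exponentˣ : ∀ k b n → k +ℕ b *ℕ suc (n +ℕ n) ≡ k +ℕ b +ℕ (b +ℕ b) *ℕ n
  exponentˣ = solve-∀

-- The finite form of Euler's identity (q;q²)_∞ (-q;q)_∞ = 1, here with q replaced by q^b.
euler-finite : ∀ b M → poch (+ 1) b (b +ℕ b) M ⊛ poch (- (+ 1)) b b (M +ℕ M) ≈ poch (+ 1) ((b +ℕ b) *ℕ suc M) (b +ℕ b) M
euler-finite b zero    = ⊛-identityˡ one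
euler-finite b (suc M) = begin
  poch (+ 1) b B (suc M) ⊛ poch (- (+ 1)) b b (suc M +ℕ suc M)
    ≈⟨ ⊛-congˡ (poch (+ 1) b B (suc M)) (≡⇒≈ (cong (λ m → poch (- (+ 1)) b b (suc m)) (ℕ.+-suc M M))) ⟩
  (poch (+ 1) b B M ⊛ f) ⊛ ((poch (- (+ 1)) b b (M +ℕ M) ⊛ g) ⊛ h)
    ≈⟨ solve 5 (λ P f R g h → (P :* f) :* ((R :* g) :* h) := ((P :* R) :* (f :* g)) :* h) ≈-refl
               (poch (+ 1) b B M) f (poch (- (+ 1)) b b (M +ℕ M)) g h ⟩
  ((poch (+ 1) b B M ⊛ poch (- (+ 1)) b b (M +ℕ M)) ⊛ (f ⊛ g)) ⊛ h
    ≈⟨ ⊛-congʳ h (⊛-cong (euler-finite b M) (⊛-congˡ f (≡⇒≈ (cong (factor (- (+ 1))) (exponentᵍ b M))))) ⟩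
  (poch (+ 1) S B M ⊛ (f ⊛ factor (- (+ 1)) e)) ⊛ h
    ≈⟨ ⊛-congʳ h (⊛-congˡ (poch (+ 1) S B M) (≈-trans (factor-⊛-conjugate e) (≡⇒≈ (cong (factor (+ 1)) (exponentᵉ b M))))) ⟩
  poch (+ 1) S B (suc M) ⊛ h
    ≈⟨ ⊛-congʳ h (poch-suc (+ 1) S B M) ⟩
  (factor (+ 1) S ⊛ poch (+ 1) (S +ℕ B) B M) ⊛ h
    ≈⟨ solve 3 (λ x P h → (x :* P) :* h := P :* (x :* h)) ≈-refl (factor (+ 1) S) (poch (+ 1) (S +ℕ B) B M) h ⟩
  poch (+ 1) (S +ℕ B) B M ⊛ (factor (+ 1) S ⊛ h)
    ≈⟨ ⊛-cong (≡⇒≈ (cong (λ s → poch (+ 1) s B M) (exponentˢ b M)))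
              (≈-trans (⊛-congˡ (factor (+ 1) S) (≡⇒≈ (cong (factor (- (+ 1))) (exponentʰ b M))))
                       (≈-trans (factor-⊛-conjugate S) (≡⇒≈ (cong (factor (+ 1)) (exponentᶠ b M))))) ⟩
  poch (+ 1) (B *ℕ suc (suc M)) B (suc M)
    ∎
  where
  open ≈-Reasoning
  B = b +ℕ b
  S = B *ℕ suc M
  e = b +ℕ B *ℕ M
  f = factor (+ 1) e
  g = factor (- (+ 1)) (b +ℕ b *ℕ (M +ℕ M))
  h = factor (- (+ 1)) (b +ℕ b *ℕ suc (M +ℕ M))
  exponentᵍ : ∀ b M → b +ℕ b *ℕ (M +ℕ M) ≡ b +ℕ (b +ℕ b) *ℕ M
  exponentᵍ = solve-∀
  exponentᵉ : ∀ b M → (b +ℕ (b +ℕ b) *ℕ M) +ℕ (b +ℕ (b +ℕ b) *ℕ M) ≡ (b +ℕ b) *ℕ suc M +ℕ (b +ℕ b) *ℕ M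
  exponentᵉ = solve-∀
  exponentˢ : ∀ b M → (b +ℕ b) *ℕ suc M +ℕ (b +ℕ b) ≡ (b +ℕ b) *ℕ suc (suc M)
  exponentˢ = solve-∀
  exponentʰ : ∀ b M → b +ℕ b *ℕ suc (M +ℕ M) ≡ (b +ℕ b) *ℕ suc M
  exponentʰ = solve-∀
  exponentᶠ : ∀ b M → (b +ℕ b) *ℕ suc M +ℕ (b +ℕ b) *ℕ suc M ≡ (b +ℕ b) *ℕ suc (suc M) +ℕ (b +ℕ b) *ℕ M
  exponentᶠ = solve-∀

recipOneMinus-periodic : ∀ m {N} → suc m ≤ N → recipOneMinus m (N ∸ suc m) ≡ recipOneMinus m N
recipOneMinus-periodic m m<N rewrite m≤n⇒[n∸m]%m≡n%m m<N = refl

recipOneMinus-< : ∀ m {N} → N < suc m → recipOneMinus m N ≡ one N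
recipOneMinus-< m {zero}  _   = refl
recipOneMinus-< m {suc N} N<m rewrite m<n⇒m%n≡m N<m = refl

recipOneMinus-telescope : ∀ m N → recipOneMinus m N + (mono (- (+ 1)) (suc m) ⊛ recipOneMinus m) N ≡ one N
recipOneMinus-telescope m N with suc m ℕ.≤? N
... | yes m<N = begin
  r N + (mono (- (+ 1)) (suc m) ⊛ r) N  ≡⟨ cong (_+_ (r N)) (mono-⊛-coeff (- (+ 1)) (suc m) r m<N) ⟩
  r N + - (+ 1) * r (N ∸ suc m)         ≡⟨ cong (_+_ (r N)) (trans (ℤ.-1*i≡-i _) (cong -_ (recipOneMinus-periodic m m<N))) ⟩
  r N + - r N                           ≡⟨ ℤ.+-inverseʳ (r N) ⟩
  + 0                                   ≡⟨ mono-≢ (+ 1) 0 N (λ { refl → ℕ.<-irrefl refl (ℕ.<-≤-trans (s≤s z≤n) m<N) }) ⟨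
  one N                                 ∎
  where
  open ≡-Reasoning
  r = recipOneMinus m
... | no m≮N = trans (cong (_+_ (recipOneMinus m N)) (mono-⊛-coeff-< (- (+ 1)) (suc m) (recipOneMinus m) (ℕ.≰⇒> m≮N)))
                     (trans (ℤ.+-identityʳ (recipOneMinus m N)) (recipOneMinus-< m (ℕ.≰⇒> m≮N)))

geometric-⊛-factor : ∀ m → recipOneMinus m ⊛ factor (+ 1) (suc m) ≈ one
geometric-⊛-factor m = begin
  r ⊛ (one ⊕ u)   ≈⟨ solve 2 (λ r u → r :* (con 1 :+ u) := r :+ u :* r) ≈-refl r u ⟩
  r ⊕ (u ⊛ r)     ≈⟨ coeffwise (recipOneMinus-telescope m) ⟩
  one             ∎
  where
  open ≈-Reasoning
  r = recipOneMinus m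
  u = mono (- (+ 1)) (suc m)

invPoch-⊛-poch : ∀ k b n → invPoch k b n ⊛ poch (+ 1) (suc k) b n ≈ one
invPoch-⊛-poch k b n = ≈-trans (≈-sym (prodTo-⊛ n _ _))
  (≈-trans (prodTo-cong n λ j _ → geometric-⊛-factor (k +ℕ b *ℕ j)) (prodTo-one n))

-- Agreement modulo q^M

infix 4 _≈[_]_
record _≈[_]_ (f : PS) (M : ℕ) (g : PS) : Set where
  constructor agreeBelow
  field coeff< : ∀ {i} → i < M → f i ≡ g i
open _≈[_]_

≈⇒≈[] : ∀ {f g} M → f ≈ g → f ≈[ M ] g
≈⇒≈[] M f≈g = agreeBelow λ {i} _ → coeff f≈g i

≈[]-refl : ∀ {f M} → f ≈[ M ] f
≈[]-refl = agreeBelow λ _ → refl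

≈[]-sym : ∀ {f g M} → f ≈[ M ] g → g ≈[ M ] f
≈[]-sym f≈g = agreeBelow λ i<M → sym (coeff< f≈g i<M)

≈[]-trans : ∀ {f g h M} → f ≈[ M ] g → g ≈[ M ] h → f ≈[ M ] h
≈[]-trans f≈g g≈h = agreeBelow λ i<M → trans (coeff< f≈g i<M) (coeff< g≈h i<M)

≈[]-setoid : ℕ → Setoid _ _
≈[]-setoid M = record
  { Carrier = PS ; _≈_ = _≈[ M ]_
  ; isEquivalence = record { refl = ≈[]-refl ; sym = ≈[]-sym ; trans = ≈[]-trans } }

module ≈[]-Reasoning M = Relation.Binary.Reasoning.Setoid (≈[]-setoid M)

≈[]-weaken : ∀ {f g M M′} → M′ ≤ M → f ≈[ M ] g → f ≈[ M′ ] g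
≈[]-weaken M′≤M f≈g = agreeBelow λ i<M′ → coeff< f≈g (ℕ.<-≤-trans i<M′ M′≤M)

≈[]-⊛-cong : ∀ {f f′ g g′ M} → f ≈[ M ] f′ → g ≈[ M ] g′ → f ⊛ g ≈[ M ] f′ ⊛ g′
≈[]-⊛-cong f≈f′ g≈g′ = agreeBelow λ {i} i<M → sumTo-cong i λ j j≤i →
  cong₂ _*_ (coeff< f≈f′ (ℕ.≤-<-trans j≤i i<M)) (coeff< g≈g′ (ℕ.≤-<-trans (ℕ.m∸n≤m i j) i<M))

mono-⊛-≈[] : ∀ {f g M} c k → f ≈[ M ] g → mono c k ⊛ f ≈[ k +ℕ M ] mono c k ⊛ g
mono-⊛-≈[] {f} {g} {M} c k f≈g = agreeBelow coeffAt
  where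
  coeffAt : ∀ {i} → i < k +ℕ M → (mono c k ⊛ f) i ≡ (mono c k ⊛ g) i
  coeffAt {i} i<k+M with k ℕ.≤? i
  ... | yes k≤i = trans (mono-⊛-coeff c k f k≤i)
                        (trans (cong (c *_) (coeff< f≈g (ℕ.+-cancelˡ-< k (i ∸ k) M
                                                   (subst (_< k +ℕ M) (sym (ℕ.m+[n∸m]≡n k≤i)) i<k+M))))
                               (sym (mono-⊛-coeff c k g k≤i)))
  ... | no k≰i  = trans (mono-⊛-coeff-< c k f (ℕ.≰⇒> k≰i)) (sym (mono-⊛-coeff-< c k g (ℕ.≰⇒> k≰i)))

≈[]-zero-⊛ : ∀ {f M} g → f ≈[ M ] zeroPS → f ⊛ g ≈[ M ] zeroPS
≈[]-zero-⊛ g f≈0 = ≈[]-trans (≈[]-⊛-cong f≈0 (≈[]-refl {g})) (≈⇒≈[] _ (⊛-zeroˡ g))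

mono-⊛-≈[]-zero : ∀ c k f → mono c k ⊛ f ≈[ k ] zeroPS
mono-⊛-≈[]-zero c k f = agreeBelow (mono-⊛-coeff-< c k f)

factor-≈[]-one : ∀ c e → factor c e ≈[ e ] one
factor-≈[]-one c e = agreeBelow λ {i} i<e →
  trans (cong (_+_ (one i)) (mono-≢ (- c) e i λ { refl → ℕ.<-irrefl refl i<e })) (ℤ.+-identityʳ (one i))

poch-≈[]-one : ∀ c k b n → poch c k b n ≈[ k ] one
poch-≈[]-one c k b zero    = agreeBelow λ _ → refl
poch-≈[]-one c k b (suc n) = begin
  poch c k b n ⊛ factor c (k +ℕ b *ℕ n)
    ≈⟨ ≈[]-⊛-cong (poch-≈[]-one c k b n) (≈[]-weaken (ℕ.m≤m+n k (b *ℕ n)) (factor-≈[]-one c _)) ⟩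
  one ⊛ one
    ≈⟨ ≈⇒≈[] k (⊛-identityˡ one) ⟩
  one
    ∎
  where open ≈[]-Reasoning k

poch-stable : ∀ c k b m n → poch c (suc k) (suc b) (m +ℕ n) ≈[ suc m ] poch c (suc k) (suc b) m
poch-stable c k b m n = begin
  poch c (suc k) (suc b) (m +ℕ n)  ≈⟨ ≈⇒≈[] (suc m) (poch-+ c (suc k) (suc b) m n) ⟩
  P ⊛ poch c e (suc b) n           ≈⟨ ≈[]-⊛-cong (≈[]-refl {P}) (≈[]-weaken (s≤s m≤e) (poch-≈[]-one c e (suc b) n)) ⟩
  P ⊛ one                          ≈⟨ ≈⇒≈[] (suc m) (⊛-identityʳ P) ⟩
  P                                ∎
  where
  open ≈[]-Reasoning (suc m)
  P = poch c (suc k) (suc b) m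
  e = suc k +ℕ suc b *ℕ m
  m≤e : m ≤ k +ℕ suc b *ℕ m
  m≤e = ℕ.≤-trans (ℕ.m≤m+n m (b *ℕ m)) (ℕ.m≤n+m (suc b *ℕ m) k)

pochInf-≈[]-poch : ∀ c k b M → pochInf c k b ≈[ M ] poch c (suc k) (suc b) M
pochInf-≈[]-poch c k b M = agreeBelow λ {i} i<M → trans
  (sym (coeff< (poch-stable c k b (suc i) (M ∸ suc i)) (ℕ.m≤n⇒m≤1+n (ℕ.n<1+n i))))
  (cong (λ l → poch c (suc k) (suc b) l i) (ℕ.m+[n∸m]≡n i<M))

⊛-coeff-top : ∀ {f g} X N → f ≈[ N ] g → (f ⊛ X) N ≡ (g ⊛ X) N → f N * X 0 ≡ g N * X 0
⊛-coeff-top X zero    _   eq = eq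
⊛-coeff-top {f} {g} X (suc t) f≈g eq = subst (λ m → f (suc t) * X m ≡ g (suc t) * X m) (ℕ.n∸n≡0 t)
  (∙-cancelˡ (sumTo t (λ i → g i * X (suc t ∸ i))) _ _
    (trans (cong (_+ f (suc t) * X (t ∸ t)) (sumTo-cong t λ i i≤t → cong (_* X (suc t ∸ i)) (sym (coeff< f≈g (s≤s i≤t))))) eq))

≈[]-cancelʳ : ∀ {f g} X M → X 0 ≡ + 1 → f ⊛ X ≈[ M ] g ⊛ X → f ≈[ M ] g
≈[]-cancelʳ X zero    _     _   = agreeBelow λ ()
≈[]-cancelʳ {f} {g} X (suc M) X₀≡1 fX≈gX = agreeBelow λ i<1+M → case≤ (ℕ.m≤n⇒m<n∨m≡n (ℕ.≤-pred i<1+M))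
  where
  f≈g : f ≈[ M ] g
  f≈g = ≈[]-cancelʳ X M X₀≡1 (≈[]-weaken (ℕ.n≤1+n M) fX≈gX)
  top : f M ≡ g M
  top = begin
    f M            ≡⟨ ℤ.*-identityʳ (f M) ⟨
    f M * + 1      ≡⟨ cong (f M *_) X₀≡1 ⟨
    f M * X 0      ≡⟨ ⊛-coeff-top X M f≈g (coeff< fX≈gX ℕ.≤-refl) ⟩
    g M * X 0      ≡⟨ cong (g M *_) X₀≡1 ⟩
    g M * + 1      ≡⟨ ℤ.*-identityʳ (g M) ⟩
    g M            ∎
    where open ≡-Reasoning
  case≤ : ∀ {i} → i < M ⊎ i ≡ M → f i ≡ g i
  case≤ (inj₁ i<M)  = coeff< f≈g i<M
  case≤ (inj₂ refl) = top

sumSeries : ℕ → (ℕ → PS) → PS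
sumSeries K F N = sumTo K (λ n → F n N)

sumSeries-cong : ∀ K {F G} → (∀ n → n ≤ K → F n ≈ G n) → sumSeries K F ≈ sumSeries K G
sumSeries-cong K F≈G = coeffwise λ N → sumTo-cong K λ n n≤K → coeff (F≈G n n≤K) N

sumSeries-⊕ : ∀ K F G → sumSeries K (λ n → F n ⊕ G n) ≈ sumSeries K F ⊕ sumSeries K G
sumSeries-⊕ K F G = coeffwise λ N → sumTo-+ K (λ n → F n N) (λ n → G n N)

sumSeries-⊛ : ∀ K F c → sumSeries K (λ n → F n ⊛ c) ≈ sumSeries K F ⊛ c
sumSeries-⊛ K F c = coeffwise λ N → trans (sumTo-swap K N λ n i → F n i * c (N ∸ i))
  (sumTo-cong N λ i _ → sym (sumTo-*ʳ K (c (N ∸ i)) λ n → F n i))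

sumSeries-suc : ∀ K F → sumSeries (suc K) F ≈ F 0 ⊕ sumSeries K (F ∘ suc)
sumSeries-suc K F = coeffwise λ N → sumTo-suc K (λ n → F n N)

HasIncreasingOrder : (ℕ → PS) → Set
HasIncreasingOrder F = ∀ n → F n ≈[ n ] zeroPS

-- The sum Σ_{n≥0} F n, meaningful when F has increasing order; lhs is sumSeries∞ summand.
sumSeries∞ : (ℕ → PS) → PS
sumSeries∞ F N = sumTo N (λ n → F n N)

sumSeries∞-coeff : ∀ {F} → HasIncreasingOrder F → ∀ {N K} → N ≤ K → sumSeries∞ F N ≡ sumSeries K F N
sumSeries∞-coeff {F} ord {N} N≤K = sumTo-extend _ (λ n → F n N) N≤K λ n N<n _ → coeff< (ord n) N<n

sumSeries∞-⊛ : ∀ {F} g → HasIncreasingOrder F → sumSeries∞ F ⊛ g ≈ sumSeries∞ (λ n → F n ⊛ g)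
sumSeries∞-⊛ {F} g ord = coeffwise λ N →
  trans (sumTo-cong N λ i i≤N → cong (_* g (N ∸ i)) (sumSeries∞-coeff ord i≤N))
        (sym (coeff (sumSeries-⊛ N F g) N))

sumSeries∞-≈[] : ∀ {F G M} → (∀ n → F n ≈[ M ] G n) → sumSeries∞ F ≈[ M ] sumSeries∞ G
sumSeries∞-≈[] F≈G = agreeBelow λ {i} i<M → sumTo-cong i λ n _ → coeff< (F≈G n) i<M

sumSeries∞-finite : ∀ {F} K → HasIncreasingOrder F → (∀ n → K < n → F n ≈ zeroPS) → sumSeries∞ F ≈ sumSeries K F
sumSeries∞-finite {F} K ord F≈0 = coeffwise λ N →
  trans (sumSeries∞-coeff ord (ℕ.m≤m+n N K))
        (sym (sumTo-extend _ (λ n → F n N) (ℕ.m≤n+m K N) λ n K<n _ → coeff (F≈0 n K<n) N))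

-- Gaussian binomial coefficients and a terminating identity

-- The Gaussian binomial coefficient [K, n] in the base q^b.
gaussian : ℕ → ℕ → ℕ → PS
gaussian b K       zero    = one
gaussian b zero    (suc n) = zeroPS
gaussian b (suc K) (suc n) = gaussian b K (suc n) ⊕ (mono (+ 1) (b *ℕ (K ∸ n)) ⊛ gaussian b K n)

gaussian-vanishes : ∀ b {K n} → K < n → gaussian b K n ≈ zeroPS
gaussian-vanishes b {zero}  {suc n} _         = ≈-refl
gaussian-vanishes b {suc K} {suc n} (s≤s K<n) = begin
  gaussian b K (suc n) ⊕ (v ⊛ gaussian b K n)
    ≈⟨ ⊕-cong (gaussian-vanishes b (ℕ.m<n⇒m<1+n K<n)) (⊛-congˡ v (gaussian-vanishes b K<n)) ⟩
  zeroPS ⊕ (v ⊛ zeroPS)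
    ≈⟨ ≈-trans (⊕-identityˡ (v ⊛ zeroPS)) (⊛-zeroʳ v) ⟩
  zeroPS
    ∎
  where
  open ≈-Reasoning
  v = mono (+ 1) (b *ℕ (K ∸ n))

poch-⊛-gaussian : ∀ b m n → poch (+ 1) b b n ⊛ gaussian b (m +ℕ n) n ≈ poch (+ 1) (b +ℕ b *ℕ m) b n
poch-⊛-gaussian b m       zero    = ⊛-identityˡ one
poch-⊛-gaussian b zero    (suc n) = begin
  (P ⊛ f) ⊛ (gaussian b n (suc n) ⊕ (mono (+ 1) (b *ℕ (n ∸ n)) ⊛ gaussian b n n))
    ≈⟨ ⊛-congˡ (P ⊛ f) (⊕-cong (gaussian-vanishes b {n} ℕ.≤-refl)
                              (⊛-congʳ (gaussian b n n) (≡⇒≈ (cong (λ e → mono (+ 1) (b *ℕ e)) (ℕ.n∸n≡0 n))))) ⟩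
  (P ⊛ f) ⊛ (zeroPS ⊕ (mono (+ 1) (b *ℕ 0) ⊛ gaussian b n n))
    ≈⟨ ⊛-congˡ (P ⊛ f) (≈-trans (⊕-identityˡ (mono (+ 1) (b *ℕ 0) ⊛ gaussian b n n))
                                (⊛-congʳ (gaussian b n n) (≡⇒≈ (cong (mono (+ 1)) (ℕ.*-zeroʳ b))))) ⟩
  (P ⊛ f) ⊛ (one ⊛ gaussian b n n)
    ≈⟨ solve 3 (λ P f g → (P :* f) :* (con 1 :* g) := (P :* g) :* f) ≈-refl P f (gaussian b n n) ⟩
  (P ⊛ gaussian b n n) ⊛ f
    ≈⟨ ⊛-cong (poch-⊛-gaussian b zero n) (≡⇒≈ (cong (factor (+ 1)) (exponent b n))) ⟩
  poch (+ 1) (b +ℕ b *ℕ 0) b (suc n)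
    ∎
  where
  open ≈-Reasoning
  P = poch (+ 1) b b n
  f = factor (+ 1) (b +ℕ b *ℕ n)
  exponent : ∀ b n → b +ℕ b *ℕ n ≡ b +ℕ b *ℕ 0 +ℕ b *ℕ n
  exponent = solve-∀
poch-⊛-gaussian b (suc m) (suc n) = begin
  P (suc n) ⊛ (G₁ ⊕ (mono (+ 1) (b *ℕ (m +ℕ suc n ∸ n)) ⊛ gaussian b (m +ℕ suc n) n))
    ≈⟨ ⊛-congˡ (P (suc n)) (⊕-congˡ G₁ (⊛-cong (≡⇒≈ (cong (mono (+ 1)) (exponentᵛ b m n)))
                                                (≡⇒≈ (cong (λ l → gaussian b l n) (ℕ.+-suc m n))))) ⟩
  (P n ⊛ f) ⊛ (G₁ ⊕ (v ⊛ G₂))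
    ≈⟨ solve 5 (λ P f G₁ v G₂ → (P :* f) :* (G₁ :+ v :* G₂) := (P :* f) :* G₁ :+ v :* (f :* (P :* G₂))) ≈-refl
               (P n) f G₁ v G₂ ⟩
  (P (suc n) ⊛ G₁) ⊕ (v ⊛ (f ⊛ (P n ⊛ G₂)))
    ≈⟨ ⊕-cong (≈-trans (poch-⊛-gaussian b m (suc n))
                       (≈-trans (poch-suc (+ 1) a b n)
                                (⊛-congˡ (factor (+ 1) a) (≡⇒≈ (cong (λ e → poch (+ 1) e b n) (exponentᵃ b m))))))
              (⊛-congˡ v (⊛-congˡ f (poch-⊛-gaussian b (suc m) n))) ⟩
  (factor (+ 1) a ⊛ E) ⊕ (v ⊛ (f ⊛ E))
    ≈⟨ solve 4 (λ u v w E → (con 1 :+ u) :* E :+ v :* ((con 1 :+ w) :* E) := E :* ((con 1 :+ (u :+ v)) :+ v :* w)) ≈-refl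
               (mono (- (+ 1)) a) v (mono (- (+ 1)) (b +ℕ b *ℕ n)) E ⟩
  E ⊛ ((one ⊕ (mono (- (+ 1)) a ⊕ v)) ⊕ (v ⊛ mono (- (+ 1)) (b +ℕ b *ℕ n)))
    ≈⟨ ⊛-congˡ E (⊕-cong (≈-trans (⊕-congˡ one (mono-⊕-neg (- (+ 1)) a)) (⊕-identityʳ one))
                         (≈-trans (mono-⊛-mono (+ 1) (- (+ 1)) a (b +ℕ b *ℕ n)) (≡⇒≈ (cong (mono (- (+ 1))) (exponentᵉ b m n))))) ⟩
  poch (+ 1) (b +ℕ b *ℕ suc m) b (suc n)
    ∎
  where
  open ≈-Reasoning
  P = λ n → poch (+ 1) b b n
  a = b +ℕ b *ℕ m
  v = mono (+ 1) a
  f = factor (+ 1) (b +ℕ b *ℕ n)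
  E = poch (+ 1) (b +ℕ b *ℕ suc m) b n
  G₁ = gaussian b (m +ℕ suc n) (suc n)
  G₂ = gaussian b (suc m +ℕ n) n
  exponentᵛ : ∀ b m n → b *ℕ (m +ℕ suc n ∸ n) ≡ b +ℕ b *ℕ m
  exponentᵛ b m n = trans (cong (b *ℕ_) (trans (cong (_∸ n) (ℕ.+-suc m n)) (ℕ.m+n∸n≡m (suc m) n))) (ℕ.*-suc b m)
  exponentᵃ : ∀ b m → b +ℕ b *ℕ m +ℕ b ≡ b +ℕ b *ℕ suc m
  exponentᵃ = solve-∀
  exponentᵉ : ∀ b m n → b +ℕ b *ℕ m +ℕ (b +ℕ b *ℕ n) ≡ b +ℕ b *ℕ suc m +ℕ b *ℕ n
  exponentᵉ = solve-∀

gaussian-≈[]-invPoch : ∀ k {K n} → n ≤ K → gaussian (suc k) K n ≈[ suc k +ℕ suc k *ℕ (K ∸ n) ] invPoch k (suc k) n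
gaussian-≈[]-invPoch k {K} {n} n≤K = begin
  gaussian b K n                  ≈⟨ ≈⇒≈[] M (≡⇒≈ (cong (λ l → gaussian b l n) (sym (ℕ.m∸n+n≡m n≤K)))) ⟩
  G                               ≈⟨ ≈⇒≈[] M (≈-sym (⊛-identityˡ G)) ⟩
  one ⊛ G                         ≈⟨ ≈⇒≈[] M (⊛-congʳ G (≈-sym (invPoch-⊛-poch k b n))) ⟩
  (c ⊛ P) ⊛ G                     ≈⟨ ≈⇒≈[] M (≈-trans (⊛-assoc c P G) (⊛-congˡ c (poch-⊛-gaussian b (K ∸ n) n))) ⟩
  c ⊛ poch (+ 1) M b n            ≈⟨ ≈[]-⊛-cong (≈[]-refl {c}) (poch-≈[]-one (+ 1) M b n) ⟩
  c ⊛ one                         ≈⟨ ≈⇒≈[] M (⊛-identityʳ c) ⟩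
  c                               ∎
  where
  open ≈[]-Reasoning (suc k +ℕ suc k *ℕ (K ∸ n))
  b = suc k
  M = b +ℕ b *ℕ (K ∸ n)
  c = invPoch k b n
  P = poch (+ 1) b b n
  G = gaussian b (K ∸ n +ℕ n) n

finiteSummand : ℕ → ℕ → ℕ → ℕ → PS
finiteSummand b a K n =
  mono (sign n) (b *ℕ n *ℕ n +ℕ a *ℕ n) ⊛ (gaussian b K n ⊛ poch (- (+ 1)) (a +ℕ b *ℕ suc n) b (K ∸ n))

finiteSummand-order : ∀ b a K → HasIncreasingOrder (finiteSummand b (suc a) K)
finiteSummand-order b a K n = ≈[]-weaken (ℕ.≤-trans (ℕ.m≤m+n n (a *ℕ n)) (ℕ.m≤n+m (suc a *ℕ n) (b *ℕ n *ℕ n)))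
  (mono-⊛-≈[]-zero (sign n) _ (gaussian b K n ⊛ poch (- (+ 1)) (suc a +ℕ b *ℕ suc n) b (K ∸ n)))

finiteSummand-vanishes : ∀ b a {K n} → K < n → finiteSummand b a K n ≈ zeroPS
finiteSummand-vanishes b a {K} {n} K<n = ≈-trans
  (⊛-congˡ (mono (sign n) _) (≈-trans (⊛-congʳ R (gaussian-vanishes b K<n)) (⊛-zeroˡ R)))
  (⊛-zeroʳ (mono (sign n) _))
  where R = poch (- (+ 1)) (a +ℕ b *ℕ suc n) b (K ∸ n)

finiteSummand-pascalˡ : ∀ b a {K n} → n ≤ K →
  mono (sign n) (b *ℕ n *ℕ n +ℕ a *ℕ n) ⊛ (gaussian b K n ⊛ poch (- (+ 1)) (a +ℕ b *ℕ suc n) b (suc K ∸ n))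
    ≈ finiteSummand b a K n ⊛ factor (- (+ 1)) (a +ℕ b *ℕ suc K)
finiteSummand-pascalˡ b a {K} {n} n≤K = begin
  M ⊛ (G ⊛ poch (- (+ 1)) s b (suc K ∸ n))
    ≈⟨ ⊛-congˡ M (⊛-congˡ G (≡⇒≈ (cong (poch (- (+ 1)) s b) (ℕ.+-∸-assoc 1 n≤K)))) ⟩
  M ⊛ (G ⊛ (R ⊛ factor (- (+ 1)) (s +ℕ b *ℕ (K ∸ n))))
    ≈⟨ ⊛-congˡ M (⊛-congˡ G (⊛-congˡ R (≡⇒≈ (cong (factor (- (+ 1))) exponent)))) ⟩
  M ⊛ (G ⊛ (R ⊛ x))
    ≈⟨ solve 4 (λ M G R x → M :* (G :* (R :* x)) := (M :* (G :* R)) :* x) ≈-refl M G R x ⟩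
  finiteSummand b a K n ⊛ x
    ∎
  where
  open ≈-Reasoning
  M = mono (sign n) (b *ℕ n *ℕ n +ℕ a *ℕ n)
  G = gaussian b K n
  s = a +ℕ b *ℕ suc n
  R = poch (- (+ 1)) s b (K ∸ n)
  x = factor (- (+ 1)) (a +ℕ b *ℕ suc K)
  split : ∀ a b n d → a +ℕ b *ℕ suc n +ℕ b *ℕ d ≡ a +ℕ b *ℕ suc (d +ℕ n)
  split = solve-∀
  exponent : s +ℕ b *ℕ (K ∸ n) ≡ a +ℕ b *ℕ suc K
  exponent = trans (split a b n (K ∸ n)) (cong (λ l → a +ℕ b *ℕ suc l) (ℕ.m∸n+n≡m n≤K))

finiteSummand-pascalʳ : ∀ b a {K m} → m ≤ K →
  mono (sign (suc m)) (b *ℕ suc m *ℕ suc m +ℕ a *ℕ suc m)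
    ⊛ ((mono (+ 1) (b *ℕ (K ∸ m)) ⊛ gaussian b K m) ⊛ poch (- (+ 1)) (a +ℕ b *ℕ suc (suc m)) b (K ∸ m))
    ≈ finiteSummand b (a +ℕ b) K m ⊛ mono (- (+ 1)) (a +ℕ b *ℕ suc K)
finiteSummand-pascalʳ b a {K} {m} m≤K = begin
  M ⊛ ((v ⊛ G) ⊛ poch (- (+ 1)) (a +ℕ b *ℕ suc (suc m)) b (K ∸ m))
    ≈⟨ ⊛-congˡ M (⊛-congˡ (v ⊛ G) (≡⇒≈ (cong (λ e → poch (- (+ 1)) e b (K ∸ m)) (exponentᴿ a b m)))) ⟩
  M ⊛ ((v ⊛ G) ⊛ R)
    ≈⟨ solve 4 (λ M v G R → M :* ((v :* G) :* R) := (M :* v) :* (G :* R)) ≈-refl M v G R ⟩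
  (M ⊛ v) ⊛ (G ⊛ R)
    ≈⟨ ⊛-congʳ (G ⊛ R) monomials ⟩
  (y ⊛ M′) ⊛ (G ⊛ R)
    ≈⟨ solve 4 (λ y M G R → (y :* M) :* (G :* R) := (M :* (G :* R)) :* y) ≈-refl y M′ G R ⟩
  finiteSummand b (a +ℕ b) K m ⊛ y
    ∎
  where
  open ≈-Reasoning
  e = b *ℕ suc m *ℕ suc m +ℕ a *ℕ suc m
  e′ = b *ℕ m *ℕ m +ℕ (a +ℕ b) *ℕ m
  E = a +ℕ b *ℕ suc K
  M = mono (sign (suc m)) e
  M′ = mono (sign m) e′
  v = mono (+ 1) (b *ℕ (K ∸ m))
  y = mono (- (+ 1)) E
  G = gaussian b K m
  R = poch (- (+ 1)) (a +ℕ b +ℕ b *ℕ suc m) b (K ∸ m)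
  exponentᴿ : ∀ a b m → a +ℕ b *ℕ suc (suc m) ≡ a +ℕ b +ℕ b *ℕ suc m
  exponentᴿ = solve-∀
  split : ∀ a b m d → b *ℕ suc m *ℕ suc m +ℕ a *ℕ suc m +ℕ b *ℕ d
                    ≡ a +ℕ b *ℕ suc (d +ℕ m) +ℕ (b *ℕ m *ℕ m +ℕ (a +ℕ b) *ℕ m)
  split = solve-∀
  monomials : M ⊛ v ≈ y ⊛ M′
  monomials = begin
    M ⊛ v
      ≈⟨ mono-⊛-mono (- sign m) (+ 1) e (b *ℕ (K ∸ m)) ⟩
    mono (- sign m * + 1) (e +ℕ b *ℕ (K ∸ m))
      ≈⟨ ≡⇒≈ (cong₂ mono (trans (ℤ.*-identityʳ (- sign m)) (sym (ℤ.-1*i≡-i (sign m))))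
                         (trans (split a b m (K ∸ m)) (cong (λ l → a +ℕ b *ℕ suc l +ℕ e′) (ℕ.m∸n+n≡m m≤K)))) ⟩
    mono (- (+ 1) * sign m) (E +ℕ e′)
      ≈⟨ mono-⊛-mono (- (+ 1)) (sign m) E e′ ⟨
    y ⊛ M′
      ∎

-- By induction on K, using the q-Pascal recurrence; the induction hypothesis is needed for a and for a + b.
finiteSummand-sum : ∀ b a K → sumSeries K (finiteSummand b a K) ≈ one
finiteSummand-sum b a zero    = ≈-trans (⊛-cong (≡⇒≈ (cong (mono (+ 1)) (exponent₀ b a))) (⊛-identityˡ one)) (⊛-identityˡ one)
  where
  exponent₀ : ∀ b a → b *ℕ 0 *ℕ 0 +ℕ a *ℕ 0 ≡ 0
  exponent₀ = solve-∀
finiteSummand-sum b a (suc K) = begin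
  sumSeries (suc K) (finiteSummand b a (suc K))
    ≈⟨ sumSeries-suc K (finiteSummand b a (suc K)) ⟩
  A 0 ⊕ sumSeries K (λ m → M (suc m) ⊛ ((gaussian b K (suc m) ⊕ (v m ⊛ gaussian b K m)) ⊛ R (suc m)))
    ≈⟨ ⊕-congˡ (A 0) (≈-trans (sumSeries-cong K λ m _ → distribute m) (sumSeries-⊕ K (A ∘ suc) B)) ⟩
  A 0 ⊕ (sumSeries K (A ∘ suc) ⊕ sumSeries K B)
    ≈⟨ solve 3 (λ a s t → a :+ (s :+ t) := (a :+ s) :+ t) ≈-refl (A 0) (sumSeries K (A ∘ suc)) (sumSeries K B) ⟩
  (A 0 ⊕ sumSeries K (A ∘ suc)) ⊕ sumSeries K B
    ≈⟨ ⊕-congʳ (sumSeries K B) (≈-sym (sumSeries-suc K A)) ⟩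
  (sumSeries K A ⊕ A (suc K)) ⊕ sumSeries K B
    ≈⟨ ⊕-cong (⊕-cong (sumSeries-cong K λ _ → finiteSummand-pascalˡ b a) lastVanishes)
              (sumSeries-cong K λ _ → finiteSummand-pascalʳ b a) ⟩
  (sumSeries K (λ n → finiteSummand b a K n ⊛ x) ⊕ zeroPS) ⊕ sumSeries K (λ m → finiteSummand b (a +ℕ b) K m ⊛ y)
    ≈⟨ ⊕-cong (≈-trans (⊕-identityʳ _) (sumSeries-⊛ K (finiteSummand b a K) x)) (sumSeries-⊛ K (finiteSummand b (a +ℕ b) K) y) ⟩
  (sumSeries K (finiteSummand b a K) ⊛ x) ⊕ (sumSeries K (finiteSummand b (a +ℕ b) K) ⊛ y)
    ≈⟨ ⊕-cong (≈-trans (⊛-congʳ x (finiteSummand-sum b a K)) (⊛-identityˡ x))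
              (≈-trans (⊛-congʳ y (finiteSummand-sum b (a +ℕ b) K)) (⊛-identityˡ y)) ⟩
  x ⊕ y
    ≈⟨ solve 2 (λ u v → (con 1 :+ u) :+ v := con 1 :+ (u :+ v)) ≈-refl (mono (+ 1) E) y ⟩
  one ⊕ (mono (+ 1) E ⊕ y)
    ≈⟨ ≈-trans (⊕-congˡ one (mono-⊕-neg (+ 1) E)) (⊕-identityʳ one) ⟩
  one
    ∎
  where
  open ≈-Reasoning
  E = a +ℕ b *ℕ suc K
  x = factor (- (+ 1)) E
  y = mono (- (+ 1)) E
  M R v A B : ℕ → PS
  M n = mono (sign n) (b *ℕ n *ℕ n +ℕ a *ℕ n)
  R n = poch (- (+ 1)) (a +ℕ b *ℕ suc n) b (suc K ∸ n)
  v m = mono (+ 1) (b *ℕ (K ∸ m))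
  A n = M n ⊛ (gaussian b K n ⊛ R n)
  B m = M (suc m) ⊛ ((v m ⊛ gaussian b K m) ⊛ R (suc m))
  distribute : ∀ m → M (suc m) ⊛ ((gaussian b K (suc m) ⊕ (v m ⊛ gaussian b K m)) ⊛ R (suc m)) ≈ A (suc m) ⊕ B m
  distribute m = solve 4 (λ M g h R → M :* ((g :+ h) :* R) := M :* (g :* R) :+ M :* (h :* R)) ≈-refl
                         (M (suc m)) (gaussian b K (suc m)) (v m ⊛ gaussian b K m) (R (suc m))
  lastVanishes : A (suc K) ≈ zeroPS
  lastVanishes = ≈-trans
    (⊛-congˡ (M (suc K)) (≈-trans (⊛-congʳ (R (suc K)) (gaussian-vanishes b {K} ℕ.≤-refl)) (⊛-zeroˡ (R (suc K)))))
    (⊛-zeroʳ (M (suc K)))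

negOddPoch : ℕ → PS
negOddPoch N = poch (- (+ 1)) 1 2 (suc N)

poch-odd-even : ∀ n → (poch (+ 1) 1 2 (suc n) ⊛ poch (- (+ 1)) 1 2 (suc n)) ⊛ (poch (+ 1) 2 2 n ⊛ poch (- (+ 1)) 2 2 n)
                      ≈ poch (+ 1) 2 2 (suc (2 *ℕ n))
poch-odd-even n = ≈-trans (⊛-cong (poch-conjugate 1 2 (suc n)) (poch-conjugate 2 2 n))
  (≈-trans (≈-sym (poch-odd-split (+ 1) 2 2 n)) (≡⇒≈ (cong (λ m → poch (+ 1) 2 2 (suc (n +ℕ m))) (sym (ℕ.+-identityʳ n)))))

summand-⊛-negOddPoch : ∀ {K n} → n ≤ K →
  summand n ⊛ negOddPoch K ≈ mono (sign n) (2 *ℕ n *ℕ n +ℕ n) ⊛ (invPoch 1 2 n ⊛ poch (- (+ 1)) (1 +ℕ 2 *ℕ suc n) 2 (K ∸ n))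
summand-⊛-negOddPoch {K} {n} n≤K = begin
  (M ⊛ (A ⊛ (B ⊛ C))) ⊛ negOddPoch K
    ≈⟨ ⊛-congˡ (M ⊛ (A ⊛ (B ⊛ C))) (≈-trans (≡⇒≈ (cong (poch (- (+ 1)) 1 2) (sym (ℕ.m+[n∸m]≡n (s≤s n≤K)))))
                                             (poch-+ (- (+ 1)) 1 2 (suc n) (K ∸ n))) ⟩
  (M ⊛ (A ⊛ (B ⊛ C))) ⊛ (D ⊛ R)
    ≈⟨ ≈-trans (≈-sym (⊛-identityʳ X)) (⊛-congˡ X (≈-sym (invPoch-⊛-poch 1 2 n))) ⟩
  ((M ⊛ (A ⊛ (B ⊛ C))) ⊛ (D ⊛ R)) ⊛ (c ⊛ P)
    ≈⟨ solve 8 (λ M A B C D R c P → ((M :* (A :* (B :* C))) :* (D :* R)) :* (c :* P)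
                                   := (((A :* D) :* (P :* B)) :* C) :* (M :* (c :* R))) ≈-refl M A B C D R c P ⟩
  (((A ⊛ D) ⊛ (P ⊛ B)) ⊛ C) ⊛ (M ⊛ (c ⊛ R))
    ≈⟨ ⊛-congʳ (M ⊛ (c ⊛ R)) (≈-trans (⊛-congʳ C (poch-odd-even n))
                                      (≈-trans (⊛-comm (poch (+ 1) 2 2 (suc (2 *ℕ n))) C) (invPoch-⊛-poch 1 2 (suc (2 *ℕ n))))) ⟩
  one ⊛ (M ⊛ (c ⊛ R))
    ≈⟨ ⊛-identityˡ (M ⊛ (c ⊛ R)) ⟩
  M ⊛ (c ⊛ R)
    ∎
  where
  open ≈-Reasoning
  M = mono (sign n) (2 *ℕ n *ℕ n +ℕ n)
  A = poch (+ 1) 1 2 (suc n)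
  B = poch (- (+ 1)) 2 2 n
  C = invPoch 1 2 (suc (2 *ℕ n))
  D = poch (- (+ 1)) 1 2 (suc n)
  R = poch (- (+ 1)) (1 +ℕ 2 *ℕ suc n) 2 (K ∸ n)
  c = invPoch 1 2 n
  P = poch (+ 1) 2 2 n
  X = (M ⊛ (A ⊛ (B ⊛ C))) ⊛ (D ⊛ R)

summand-order : HasIncreasingOrder summand
summand-order n = ≈[]-weaken (ℕ.m≤n+m n (2 *ℕ n *ℕ n))
  (mono-⊛-≈[]-zero (sign n) _ (poch (+ 1) 1 2 (suc n) ⊛ (poch (- (+ 1)) 2 2 n ⊛ invPoch 1 2 (suc (2 *ℕ n)))))

summand-⊛-negOddPoch-≈[] : ∀ N n → summand n ⊛ negOddPoch N ≈[ suc N ] finiteSummand 2 1 N n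
summand-⊛-negOddPoch-≈[] N n with n ℕ.≤? N
... | yes n≤N = begin
  summand n ⊛ negOddPoch N
    ≈⟨ ≈⇒≈[] (suc N) (summand-⊛-negOddPoch n≤N) ⟩
  mono (sign n) e ⊛ (invPoch 1 2 n ⊛ R)
    ≈⟨ ≈[]-weaken bound (mono-⊛-≈[] (sign n) e (≈[]-⊛-cong (≈[]-sym (gaussian-≈[]-invPoch 1 n≤N)) (≈[]-refl {R}))) ⟩
  mono (sign n) e ⊛ (gaussian 2 N n ⊛ R)
    ≈⟨ ≈⇒≈[] (suc N) (⊛-congʳ (gaussian 2 N n ⊛ R)
                               (≡⇒≈ (cong (λ l → mono (sign n) (2 *ℕ n *ℕ n +ℕ l)) (sym (ℕ.*-identityˡ n))))) ⟩
  finiteSummand 2 1 N n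
    ∎
  where
  open ≈[]-Reasoning (suc N)
  e = 2 *ℕ n *ℕ n +ℕ n
  R = poch (- (+ 1)) (1 +ℕ 2 *ℕ suc n) 2 (N ∸ n)
  rearrange : ∀ n d → 2 *ℕ n *ℕ n +ℕ n +ℕ (2 +ℕ 2 *ℕ d) ≡ suc (d +ℕ n) +ℕ (2 *ℕ n *ℕ n +ℕ 1 +ℕ d)
  rearrange = solve-∀
  bound : suc N ≤ e +ℕ (2 +ℕ 2 *ℕ (N ∸ n))
  bound = subst₂ _≤_ (cong suc (ℕ.m∸n+n≡m n≤N)) (sym (rearrange n (N ∸ n))) (ℕ.m≤m+n _ _)
... | no n≰N = ≈[]-trans (≈[]-weaken (ℕ.≰⇒> n≰N) (≈[]-zero-⊛ (negOddPoch N) (summand-order n)))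
                         (≈⇒≈[] (suc N) (≈-sym (finiteSummand-vanishes 2 1 (ℕ.≰⇒> n≰N))))

lhs-⊛-negOddPoch : ∀ N → lhs ⊛ negOddPoch N ≈[ suc N ] one
lhs-⊛-negOddPoch N = begin
  lhs ⊛ negOddPoch N
    ≈⟨ ≈⇒≈[] (suc N) (sumSeries∞-⊛ (negOddPoch N) summand-order) ⟩
  sumSeries∞ (λ n → summand n ⊛ negOddPoch N)
    ≈⟨ sumSeries∞-≈[] (summand-⊛-negOddPoch-≈[] N) ⟩
  sumSeries∞ (finiteSummand 2 1 N)
    ≈⟨ ≈⇒≈[] (suc N) (sumSeries∞-finite N (finiteSummand-order 2 0 N) λ _ → finiteSummand-vanishes 2 1) ⟩
  sumSeries N (finiteSummand 2 1 N)
    ≈⟨ ≈⇒≈[] (suc N) (finiteSummand-sum 2 1 N) ⟩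
  one
    ∎
  where open ≈[]-Reasoning (suc N)

rhs-⊛-negOddPoch : ∀ N → rhs ⊛ negOddPoch N ≈[ suc N ] one
rhs-⊛-negOddPoch N = begin
  (pochInf (+ 1) 0 1 ⊛ pochInf (- (+ 1)) 1 1) ⊛ X
    ≈⟨ ≈[]-⊛-cong (≈[]-⊛-cong (pochInf-≈[]-poch (+ 1) 0 1 L)
                              (≈[]-weaken (ℕ.m≤m+n L L) (pochInf-≈[]-poch (- (+ 1)) 1 1 (L +ℕ L))))
                  (≈[]-refl {X}) ⟩
  (A ⊛ B) ⊛ X
    ≈⟨ ≈⇒≈[] L (solve 3 (λ A B X → (A :* B) :* X := (A :* X) :* B) ≈-refl A B X) ⟩
  (A ⊛ X) ⊛ B
    ≈⟨ ≈⇒≈[] L (≈-trans (⊛-congʳ B (poch-conjugate 1 2 L)) (euler-finite 2 L)) ⟩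
  poch (+ 1) (4 *ℕ suc L) 4 L
    ≈⟨ ≈[]-weaken (ℕ.≤-trans (ℕ.n≤1+n L) (ℕ.m≤m+n (suc L) (3 *ℕ suc L))) (poch-≈[]-one (+ 1) (4 *ℕ suc L) 4 L) ⟩
  one
    ∎
  where
  open ≈[]-Reasoning (suc N)
  L = suc N
  X = negOddPoch N
  A = poch (+ 1) 1 2 L
  B = poch (- (+ 1)) 2 2 (L +ℕ L)

corollary4p2 : (N : ℕ) → lhs N ≡ rhs N
corollary4p2 N = coeff< lhs≈rhs (ℕ.n<1+n N)
  where
  lhs≈rhs : lhs ≈[ suc N ] rhs
  lhs≈rhs = ≈[]-cancelʳ (negOddPoch N) (suc N) (coeff< (poch-≈[]-one (- (+ 1)) 1 2 (suc N)) (s≤s z≤n))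
                        (≈[]-trans (lhs-⊛-negOddPoch N) (≈[]-sym (rhs-⊛-negOddPoch N)))
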